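{- Let $A$ be an atomic type, $f:A\to(\mathbb{N}\to A)$ a closed term of $\mathcal{T}$, and $\mathcal{N}:A\to(\mathbb{N}\to\mathbb{N})\to(\mathbb{N}\to\mathbb{N})$ a closed term such that for every object $a$ of type $A$, $\mathcal{N}_a$ is a modulus of convergence for $f_a$. Let $g:\mathbb{N}\to A$ be closed and let $\mathcal{M}$ be a modulus of convergence for $g$. Define $\mathcal{N}'_h:=\lambda n^{\mathbb{N}}.(\mathcal{N}_{g(n)}h)\,n$ and $\mathcal{H}_1(\mathcal{M},\mathcal{N},g):=\lambda h^{\mathbb{N}\to\mathbb{N}}\lambda z^{\mathbb{N}}.\,\mathcal{N}'_h(\mathcal{M}_{h\circ\mathcal{N}'_h}(z))$. Then $\mathcal{H}_1(\mathcal{M},\mathcal{N},g)$ is a modulus of convergence for $\lambda n^{\mathbb{N}}.\,f_{g(n)}(n)$.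
   Context: $\mathcal{T}$ is a simple extension of Gödel's system (simply typed $\lambda$-calculus over $\mathbb{N},\mathsf{Bool}$ with products, arrows, $0,\mathsf{S}$, booleans, conditionals, recursors in all types, possibly extended by atomic types and constants with functional reduction rules on closed normal atomic arguments). An object of type $A$ is a closed normal term of type $A$. Equality is provable equality in $\mathcal{T}$; $f_a$ denotes $fa$, $\mathcal{M}_h$ denotes $\mathcal{M}h$, and $h\circ g:=\lambda x.h(g(x))$. For $f:\mathbb{N}\to A$ and numerals $n\le m$, $f\downarrow[n,m]$ means $f(x)=f(n)$ for all $n\le x\le m$; $h\ge\mathrm{id}$ means $h(x)\ge x$ for all numerals $x$. A closed term $\mathcal{L}:(\mathbb{N}\to\mathbb{N})\to(\mathbb{N}\to\mathbb{N})$ is a modulus of convergence for a closed $f:\mathbb{N}\to A$ ($A$ atomic) if for every closed $h:\mathbb{N}\to\mathbb{N}$ with $h\ge\mathrm{id}$: (1) $\mathcal{L}_h\ge\mathrm{id}$, and (2) $f\downarrow[\mathcal{L}_h(z),h(\mathcal{L}_h(z))]$ for every numeral $z$. -}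

module Defs where

open import Data.Nat using (ℕ; _≤_)
open import Data.Product using (_×_)
open import Relation.Binary.PropositionalEquality using (_≡_)

_≥id : (ℕ → ℕ) → Set
h ≥id = ∀ x → x ≤ h x

_↓[_,_] : {A : Set} → (ℕ → A) → ℕ → ℕ → Set
f ↓[ n , m ] = ∀ x → n ≤ x → x ≤ m → f x ≡ f n

IsModulus : {A : Set} → ((ℕ → ℕ) → (ℕ → ℕ)) → (ℕ → A) → Set
IsModulus L f = ∀ (h : ℕ → ℕ) → h ≥id →
  (L h ≥id) × (∀ z → f ↓[ L h z , h (L h z) ])

_∘'_ : (ℕ → ℕ) → (ℕ → ℕ) → (ℕ → ℕ)
(h ∘' g) x = h (g x)

N′ : {A : Set} → (A → (ℕ → ℕ) → (ℕ → ℕ)) → (ℕ → A) → (ℕ → ℕ) → (ℕ → ℕ)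
N′ N g h n = N (g n) h n

H₁ : {A : Set} → ((ℕ → ℕ) → (ℕ → ℕ)) → (A → (ℕ → ℕ) → (ℕ → ℕ)) → (ℕ → A) →
     (ℕ → ℕ) → (ℕ → ℕ)
H₁ M N g h z = N′ N g h (M (h ∘' N′ N g h) z)

-- Put m := M_{h ∘ N'_h}(z) and L := N'_h(m) = N_{g(m)} h m, so m ≤ L ≤ h(L).  The modulus of g,
-- applied to h ∘ N'_h, makes g constant on [m, h(L)], hence equal to g(m) on [L, h(L)]; there the
-- diagonal n ↦ f_{g(n)}(n) coincides with f_{g(m)}, which N_{g(m)} makes constant on [L, h(L)].
module Submission where

open import Defs
open import Data.Nat using (ℕ; _≤_)
open import Data.Nat.Properties using (≤-refl; ≤-trans)
open import Data.Product using (_×_; _,_; proj₁; proj₂)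
open import Relation.Binary.PropositionalEquality using (_≡_; cong; sym; module ≡-Reasoning)

≥id-∘ : ∀ {h k} → h ≥id → k ≥id → (h ∘' k) ≥id
≥id-∘ {k = k} h≥id k≥id x = ≤-trans (k≥id x) (h≥id (k x))

↓-restrict : ∀ {A : Set} {u : ℕ → A} {n m n′ m′} →
             u ↓[ n , m ] → n ≤ n′ → n′ ≤ m′ → m′ ≤ m → u ↓[ n′ , m′ ]
↓-restrict {u = u} {n = n} {n′ = n′} u↓ n≤n′ n′≤m′ m′≤m x n′≤x x≤m′ = begin
  u x   ≡⟨ u↓ x (≤-trans n≤n′ n′≤x) (≤-trans x≤m′ m′≤m) ⟩
  u n   ≡⟨ sym (u↓ n′ n≤n′ (≤-trans n′≤m′ m′≤m)) ⟩
  u n′  ∎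
  where open ≡-Reasoning

↓-diagonal : ∀ {A B : Set} (f : A → ℕ → B) {g : ℕ → A} {n m a} →
             g ↓[ n , m ] → g n ≡ a → f a ↓[ n , m ] → (λ x → f (g x) x) ↓[ n , m ]
↓-diagonal f {g} {n} {a = a} g↓ gn≡a fa↓ x n≤x x≤m = begin
  f (g x) x  ≡⟨ cong (λ b → f b x) (g↓ x n≤x x≤m) ⟩
  f (g n) x  ≡⟨ cong (λ b → f b x) gn≡a ⟩
  f a x      ≡⟨ fa↓ x n≤x x≤m ⟩
  f a n      ≡⟨ cong (λ b → f b n) (sym gn≡a) ⟩
  f (g n) n  ∎
  where open ≡-Reasoning

mainTheorem10 : {A : Set} (f : A → ℕ → A) (N : A → (ℕ → ℕ) → (ℕ → ℕ))
    → (∀ a → IsModulus (N a) (f a))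
    → (g : ℕ → A) (M : (ℕ → ℕ) → (ℕ → ℕ))
    → IsModulus M g
    → IsModulus (H₁ M N g) (λ n → f (g n) n)
mainTheorem10 f N N-modulus g M M-modulus h h≥id = H≥id , H-converges
  where
  N′≥id : N′ N g h ≥id
  N′≥id n = proj₁ (N-modulus (g n) h h≥id) n

  k : ℕ → ℕ
  k = h ∘' N′ N g h

  M-converges : M k ≥id × (∀ z → g ↓[ M k z , k (M k z) ])
  M-converges = M-modulus k (≥id-∘ h≥id N′≥id)

  H≥id : H₁ M N g h ≥id
  H≥id z = ≤-trans (proj₁ M-converges z) (N′≥id (M k z))

  H-converges : ∀ z → (λ n → f (g n) n) ↓[ H₁ M N g h z , h (H₁ M N g h z) ]
  H-converges z = ↓-diagonal f g↓ (g↓m L m≤L (h≥id L)) (proj₂ (N-modulus (g m) h h≥id) m)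
    where
    m L : ℕ
    m = M k z
    L = N′ N g h m
    m≤L : m ≤ L
    m≤L = N′≥id m
    g↓m : g ↓[ m , h L ]
    g↓m = proj₂ M-converges z
    g↓ : g ↓[ L , h L ]
    g↓ = ↓-restrict g↓m m≤L (h≥id L) ≤-refl
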